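{- Let $X = \mathbb{Z}_{(2)} = \{a/b \in \mathbb{Q} : a,b \in \mathbb{Z},\ 2 \nmid b\}$ and $Y = \mathbb{Z}_{(3)} = \{a/b \in \mathbb{Q} : a,b \in \mathbb{Z},\ 3 \nmid b\}$, as ordered subgroups of $\mathbb{Q}$. Define $$\Gamma_1 = \bigoplus_{\mathbb{N}} \Big( \big(\bigoplus_{\mathbb{N}} Y\big) \oplus X \Big), \qquad \Gamma_2 = \bigoplus_{\mathbb{N}'} (X \oplus Y),$$ and $\Gamma = \Gamma_2 \oplus \Gamma_1$. Then the convex subgroup $\{0\} \oplus \Gamma_1$ of $\Gamma$ is definable in $\Gamma$ by a parameter-free formula in the language of ordered abelian groups $\mathcal{L}_{\mathrm{oag}} = \{+,-,0,<\}$.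
   Context: For a totally ordered index set $(I,<)$ and ordered abelian groups $(G_i)_{i \in I}$, the Hahn sum $\bigoplus_{i \in I} G_i$ is the group of families $(g_i)_{i\in I} \in \prod_{i \in I} G_i$ with finite support, with componentwise addition and lexicographic order in which $G_i$ is more significant than $G_{i'}$ whenever $i < i'$ (so a nonzero element is positive iff its component at the smallest index of its support is positive). For two groups, $G \oplus H$ is the lexicographic sum on $G \times H$ with $G$ more significant. $(\mathbb{N},<)$ denotes the natural numbers with the usual order and $\mathbb{N}'$ denotes the natural numbers with the reverse order. -}

module Defs where

open import Data.Nat as ℕ using (ℕ; suc)
open import Data.Nat.Divisibility using (_∣_)
open import Data.Integer using (ℤ)
open import Data.Rational as Q using (ℚ; 0ℚ; _/_)
open import Data.Fin using (Fin; zero; suc)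
open import Data.Product using (Σ; _×_; _,_; proj₁; proj₂)
open import Data.Sum using (_⊎_)
open import Relation.Nullary using (¬_)
open import Relation.Binary.PropositionalEquality using (_≡_)

-- The groups X = ℤ_(2), Y = ℤ_(3) as subsets of ℚ (literal definition:
-- q = a / b with 2 ∤ b, resp. 3 ∤ b; w.l.o.g. b > 0, written b = suc k).

InZloc : ℕ → ℚ → Set
InZloc p q = Σ ℤ λ a → Σ ℕ λ k → (¬ (p ∣ suc k)) × (q ≡ a / suc k)

InX InY : ℚ → Set
InX = InZloc 2
InY = InZloc 3

Zℚ : ℚ → Set
Zℚ q = q ≡ 0ℚ

Pℚ : ℚ → Set
Pℚ q = 0ℚ Q.< q

-- lexicographic sum A ⊕ B (A more significant)
ZPair : {A B : Set} → (A → Set) → (B → Set) → A × B → Set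
ZPair Za Zb (a , b) = Za a × Zb b

PPair : {A B : Set} → (A → Set) → (A → Set) → (B → Set) → A × B → Set
PPair Za Pa Pb (a , b) = Pa a ⊎ (Za a × Pb b)

ZSeq : {A : Set} → (A → Set) → (ℕ → A) → Set
ZSeq Z f = ∀ n → Z (f n)

FinSupp : {A : Set} → (A → Set) → (ℕ → A) → Set
FinSupp Z f = Σ ℕ λ N → ∀ n → N ℕ.≤ n → Z (f n)

-- Hahn sum over (ℕ,<): smallest index of the support most significant
PSeqℕ : {A : Set} → (A → Set) → (A → Set) → (ℕ → A) → Set
PSeqℕ Z P f = Σ ℕ λ n → (∀ m → m ℕ.< n → Z (f m)) × P (f n)

-- Hahn sum over ℕ' (reverse order): largest index of the support most significant
PSeqℕ' : {A : Set} → (A → Set) → (A → Set) → (ℕ → A) → Set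
PSeqℕ' Z P f = Σ ℕ λ n → (∀ m → n ℕ.< m → Z (f m)) × P (f n)

-- Elements are represented by families of rationals;
-- membership (values in X/Y, finite supports) is the predicate MemΓ.

G₂ G₁ G : Set
G₂ = ℕ → ℚ × ℚ
G₁ = ℕ → (ℕ → ℚ) × ℚ
G  = G₂ × G₁

MemΓ₂ : G₂ → Set
MemΓ₂ u = (∀ n → InX (proj₁ (u n)) × InY (proj₂ (u n)))
        × FinSupp (ZPair Zℚ Zℚ) u

MemΓ₁ : G₁ → Set
MemΓ₁ v = (∀ n → (∀ m → InY (proj₁ (v n) m))
               × FinSupp Zℚ (proj₁ (v n))
               × InX (proj₂ (v n)))
        × FinSupp (ZPair (ZSeq Zℚ) Zℚ) v

MemΓ : G → Set
MemΓ (u , v) = MemΓ₂ u × MemΓ₁ v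

0Γ : G
0Γ = (λ _ → 0ℚ , 0ℚ) , (λ _ → (λ _ → 0ℚ) , 0ℚ)

_+Γ_ : G → G → G
(u , v) +Γ (u' , v') =
  (λ n → (proj₁ (u n) Q.+ proj₁ (u' n)) , (proj₂ (u n) Q.+ proj₂ (u' n))) ,
  (λ n → (λ m → proj₁ (v n) m Q.+ proj₁ (v' n) m) , (proj₂ (v n) Q.+ proj₂ (v' n)))

-Γ_ : G → G
-Γ (u , v) =
  (λ n → Q.- proj₁ (u n) , Q.- proj₂ (u n)) ,
  (λ n → (λ m → Q.- proj₁ (v n) m) , Q.- proj₂ (v n))

ZΓ₂ : G₂ → Set
ZΓ₂ = ZSeq (ZPair Zℚ Zℚ)

PΓ₂ : G₂ → Set
PΓ₂ = PSeqℕ' (ZPair Zℚ Zℚ) (PPair Zℚ Pℚ Pℚ)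

ZΓ₁ : G₁ → Set
ZΓ₁ = ZSeq (ZPair (ZSeq Zℚ) Zℚ)

PΓ₁ : G₁ → Set
PΓ₁ = PSeqℕ (ZPair (ZSeq Zℚ) Zℚ) (PPair (ZSeq Zℚ) (PSeqℕ Zℚ Pℚ) Pℚ)

ZΓ PΓ : G → Set
ZΓ = ZPair ZΓ₂ ZΓ₁
PΓ = PPair ZΓ₂ PΓ₂ PΓ₁

_≈Γ_ _<Γ_ : G → G → Set
x ≈Γ y = ZΓ (x +Γ (-Γ y))
x <Γ y = PΓ (y +Γ (-Γ x))

InH : G → Set
InH (u , v) = ZΓ₂ u

-- First-order language L_oag = {+, -, 0, <} (with equality), formulas
-- with n free variables (de Bruijn via Fin).

data Term (n : ℕ) : Set where
  var  : Fin n → Term n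
  zer  : Term n
  _⊕_  : Term n → Term n → Term n
  ⊝_   : Term n → Term n

data Formula : ℕ → Set where
  _≐_  : {n : ℕ} → Term n → Term n → Formula n
  _≺_  : {n : ℕ} → Term n → Term n → Formula n
  ¬'_  : {n : ℕ} → Formula n → Formula n
  _∧'_ : {n : ℕ} → Formula n → Formula n → Formula n
  _∨'_ : {n : ℕ} → Formula n → Formula n → Formula n
  _⇒'_ : {n : ℕ} → Formula n → Formula n → Formula n
  ∀'_  : {n : ℕ} → Formula (suc n) → Formula n
  ∃'_  : {n : ℕ} → Formula (suc n) → Formula n

Env : ℕ → Set
Env n = Fin n → G

ext : {n : ℕ} → G → Env n → Env (suc n)
ext g ρ zero    = g
ext g ρ (suc i) = ρ i

eval : {n : ℕ} → Env n → Term n → G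
eval ρ (var i) = ρ i
eval ρ zer     = 0Γ
eval ρ (s ⊕ t) = eval ρ s +Γ eval ρ t
eval ρ (⊝ t)   = -Γ eval ρ t

-- Classical (Tarskian) satisfaction in Γ, rendered via the
-- double-negation translation; quantifiers range over elements of Γ.
Sat : {n : ℕ} → Formula n → Env n → Set
Sat (s ≐ t)  ρ = ¬ ¬ (eval ρ s ≈Γ eval ρ t)
Sat (s ≺ t)  ρ = ¬ ¬ (eval ρ s <Γ eval ρ t)
Sat (¬' φ)   ρ = ¬ Sat φ ρ
Sat (φ ∧' ψ) ρ = Sat φ ρ × Sat ψ ρ
Sat (φ ∨' ψ) ρ = ¬ (¬ Sat φ ρ × ¬ Sat ψ ρ)
Sat (φ ⇒' ψ) ρ = Sat φ ρ → Sat ψ ρ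
Sat (∀' φ)   ρ = ∀ g → MemΓ g → Sat φ (ext g ρ)
Sat (∃' φ)   ρ = ¬ (∀ g → MemΓ g → ¬ Sat φ (ext g ρ))

[_] : G → Env 1
[ g ] zero = g

module Submission where

-- Flattening Γ₂ puts the X- and Y-coordinates of its n-th summand at positions 2n+1 and 2n
-- of one sequence, ordered reverse-lexicographically (larger positions more significant).
-- Every nonzero element of Γ₂ dominates Γ₁.  The defining formula φH(x) says that there are
-- a > b > d > 0 with |x| < b such that
--   (I)  ∀ z w. |z - 2w| < a → ∃ w'. |z - 2w'| < d,
--   (N1) ∀ w. ¬ |a - 3w| < b,
--   (N2) ∀ w. ¬ |b - 3w| < d.
-- If x ∈ Γ₁, take a = 1 at the least significant Γ₂-coordinate (a Y-coordinate) and b, d in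
-- the first copy of Y inside Γ₁: 2 is invertible in Y and 1, 1 + 3T are not divisible by 3.
-- If x ∉ Γ₁, let k be the leading Γ₂-position of b: for odd k (an X-coordinate) (I) fails as
-- X is not 2-divisible, or (N2) fails as 3 is invertible in X; for even k (a Y-coordinate)
-- (I) fails one position higher, or (N1) fails because 3Y is dense around Y.

open import Defs
open import Data.Bool using (Bool; true; false)
open import Data.Empty using (⊥; ⊥-elim)
open import Data.Fin using (zero; suc)
open import Data.Integer as ℤ using (+_; -[1+_])
import Data.Integer.Properties as ℤP
open import Data.Nat as ℕ using (ℕ; zero; suc; z≤n; s≤s; NonZero; nonTrivial⇒n>1)
open import Data.Nat.Divisibility using (_∣_; _∣?_; divides; >⇒∤; ∣m+n∣m⇒∣n; m∣m*n)
open import Data.Nat.Primality using (Prime; prime?; euclidsLemma; prime⇒nonZero; prime⇒nonTrivial)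
import Data.Nat.Properties as ℕP
open import Data.Product using (Σ; _×_; _,_; proj₁; proj₂)
open import Data.Rational as Q using (ℚ; 0ℚ; 1ℚ; _/_; mkℚ; fromℚᵘ)
import Data.Rational.Properties as QP
open import Data.Rational.Solver using (module +-*-Solver)
open import Data.Rational.Unnormalised as U using (mkℚᵘ; *≡*; *<*)
import Data.Rational.Unnormalised.Properties as UP
open import Data.Sum using (_⊎_; inj₁; inj₂) renaming ([_,_] to either)
open import Function.Bundles using (_⇔_; mk⇔)
open import Relation.Binary.Definitions using (tri<; tri≈; tri>)
open import Relation.Binary.PropositionalEquality hiding ([_])
open import Relation.Nullary using (¬_; yes; no)
open import Relation.Nullary.Decidable using (from-yes; from-no)

open import Algebra.Properties.Group QP.+-0-group using () renaming (⁻¹-involutive to neg-involutive)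
open +-*-Solver using (solve; _:+_; _:*_; :-_; _:=_; con)

-- The rational a / (k+1) is by definition fromℚᵘ (mkℚᵘ a k).  The next four facts
-- let ring operations and the order on such fractions be computed on their
-- unnormalised representatives, i.e. by cross-multiplying numerators and denominators.

fromℚᵘ-+ : ∀ u v → fromℚᵘ u Q.+ fromℚᵘ v ≡ fromℚᵘ (u U.+ v)
fromℚᵘ-+ u v = QP.toℚᵘ-injective
  (UP.≃-trans (QP.toℚᵘ-homo-+ (fromℚᵘ u) (fromℚᵘ v))
  (UP.≃-trans (UP.+-cong (QP.toℚᵘ-fromℚᵘ u) (QP.toℚᵘ-fromℚᵘ v))
              (UP.≃-sym (QP.toℚᵘ-fromℚᵘ (u U.+ v)))))

fromℚᵘ-* : ∀ u v → fromℚᵘ u Q.* fromℚᵘ v ≡ fromℚᵘ (u U.* v)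
fromℚᵘ-* u v = QP.toℚᵘ-injective
  (UP.≃-trans (QP.toℚᵘ-homo-* (fromℚᵘ u) (fromℚᵘ v))
  (UP.≃-trans (UP.*-cong (QP.toℚᵘ-fromℚᵘ u) (QP.toℚᵘ-fromℚᵘ v))
              (UP.≃-sym (QP.toℚᵘ-fromℚᵘ (u U.* v)))))

fromℚᵘ-neg : ∀ u → Q.- fromℚᵘ u ≡ fromℚᵘ (U.- u)
fromℚᵘ-neg u = QP.toℚᵘ-injective
  (UP.≃-trans (QP.toℚᵘ-homo‿- (fromℚᵘ u))
  (UP.≃-trans (UP.-‿cong (QP.toℚᵘ-fromℚᵘ u))
              (UP.≃-sym (QP.toℚᵘ-fromℚᵘ (U.- u)))))

fromℚᵘ-< : ∀ {u v} → u U.< v → fromℚᵘ u Q.< fromℚᵘ v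
fromℚᵘ-< {u} {v} u<v = QP.toℚᵘ-cancel-<
  (UP.<-respˡ-≃ (UP.≃-sym (QP.toℚᵘ-fromℚᵘ u)) (UP.<-respʳ-≃ (UP.≃-sym (QP.toℚᵘ-fromℚᵘ v)) u<v))

as-fraction : ∀ q → Q.↥ q / suc (ℚ.denominator-1 q) ≡ q
as-fraction = QP.↥p/↧p≡p

neg-as-fraction : ∀ q → (ℤ.- Q.↥ q) / suc (ℚ.denominator-1 q) ≡ Q.- q
neg-as-fraction q =
  trans (sym (fromℚᵘ-neg (mkℚᵘ (Q.↥ q) (ℚ.denominator-1 q)))) (cong Q.-_ (as-fraction q))

fraction-below : ∀ b k c l A → ℤ.∣ b ∣ ℕ.≤ A → A ℕ.* suc l ℕ.< suc c ℕ.* suc k →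
                 b / suc k Q.< + suc c / suc l
fraction-below -[1+ j ] k c l A _ _ = fromℚᵘ-< {mkℚᵘ -[1+ j ] k} {mkℚᵘ (+ suc c) l} (*<* ℤ.-<+)
fraction-below (+ j) k c l A j≤A bound = fromℚᵘ-< {mkℚᵘ (+ j) k} {mkℚᵘ (+ suc c) l}
  (*<* (subst₂ ℤ._<_ (ℤP.pos-* j (suc l)) (ℤP.pos-* (suc c) (suc k))
                     (ℤ.+<+ (ℕP.≤-<-trans (ℕP.*-monoˡ-≤ (suc l) j≤A) bound))))

ι : ℕ → ℚ
ι n = + n / 1

ι-+ : ∀ m n → ι (m ℕ.+ n) ≡ ι m Q.+ ι n
ι-+ m n = trans (QP./-cong (sym (trans (cong₂ ℤ._+_ (ℤP.*-identityʳ (+ m)) (ℤP.*-identityʳ (+ n)))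
                                        (sym (ℤP.pos-+ m n)))) refl)
                (sym (fromℚᵘ-+ (mkℚᵘ (+ m) 0) (mkℚᵘ (+ n) 0)))

ι-* : ∀ m n → ι (m ℕ.* n) ≡ ι m Q.* ι n
ι-* m n = trans (QP./-cong (ℤP.pos-* m n) refl) (sym (fromℚᵘ-* (mkℚᵘ (+ m) 0) (mkℚᵘ (+ n) 0)))

ι-suc-* : ∀ m n → ι (suc (m ℕ.* n)) ≡ 1ℚ Q.+ ι m Q.* ι n
ι-suc-* m n = trans (ι-+ 1 (m ℕ.* n)) (cong (1ℚ Q.+_) (ι-* m n))

0<ι-suc : ∀ n → 0ℚ Q.< ι (suc n)
0<ι-suc n = fromℚᵘ-< {mkℚᵘ (+ 0) 0} {mkℚᵘ (+ suc n) 0} (*<* (ℤ.+<+ (s≤s z≤n)))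

reciprocal : ∀ m → (+ 1 / suc m) Q.* ι (suc m) ≡ 1ℚ
reciprocal m = trans (fromℚᵘ-* (mkℚᵘ (+ 1) m) (mkℚᵘ (+ suc m) 0))
  (QP.fromℚᵘ-cong {mkℚᵘ (+ 1) m U.* mkℚᵘ (+ suc m) 0} {mkℚᵘ (+ 1) 0} (*≡* (begin
    + 1 ℤ.* + suc m ℤ.* + 1   ≡⟨ ℤP.*-identityʳ _ ⟩
    + 1 ℤ.* + suc m           ≡⟨ cong (λ n → + 1 ℤ.* + n) (ℕP.*-identityʳ (suc m)) ⟨
    + 1 ℤ.* + (suc m ℕ.* 1)   ∎)))
  where open ≡-Reasoning

positive-fraction : ∀ r → 0ℚ Q.< r → Σ ℕ λ n → Σ ℕ λ d → r ≡ + suc n / suc d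
positive-fraction r@(mkℚ (+ suc n) d _) _ = n , d , sym (as-fraction r)
positive-fraction (mkℚ (+ 0) d _) 0<r with QP.drop-*<* 0<r
... | ℤ.+<+ ()
positive-fraction (mkℚ -[1+ n ] d _) 0<r with QP.drop-*<* 0<r
... | ()

abs-below : ∀ m .{{_ : NonZero m}} q →
            (q Q.< ι (suc (m ℕ.* ℤ.∣ Q.↥ q ∣))) × (Q.- q Q.< ι (suc (m ℕ.* ℤ.∣ Q.↥ q ∣)))
abs-below m q = subst (Q._< B) (as-fraction q) (below a ℕP.≤-refl)
              , subst (Q._< B) (neg-as-fraction q) (below (ℤ.- a) (ℕP.≤-reflexive (ℤP.∣-i∣≡∣i∣ a)))
  where
  a = Q.↥ q
  k = ℚ.denominator-1 q
  A = ℤ.∣ a ∣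
  B = ι (suc (m ℕ.* A))
  below : ∀ b → ℤ.∣ b ∣ ℕ.≤ A → b / suc k Q.< B
  below b b≤A = fraction-below b k (m ℕ.* A) 0 A b≤A (begin-strict
    A ℕ.* 1                  ≡⟨ ℕP.*-identityʳ A ⟩
    A                        ≤⟨ ℕP.m≤n*m A m ⟩
    m ℕ.* A                  <⟨ ℕP.n<1+n _ ⟩
    suc (m ℕ.* A)            ≤⟨ ℕP.m≤m*n (suc (m ℕ.* A)) (suc k) ⟩
    suc (m ℕ.* A) ℕ.* suc k  ∎)
    where open ℕP.≤-Reasoning

archimedean : ∀ m .{{_ : NonZero m}} q r → 0ℚ Q.< r → Σ ℕ λ N →
              (q Q.* (+ 1 / suc (m ℕ.* N)) Q.< r) × (Q.- q Q.* (+ 1 / suc (m ℕ.* N)) Q.< r)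
archimedean m q r 0<r with positive-fraction r 0<r
... | n , d , refl =
  N , subst (λ v → v Q.* u Q.< r) (as-fraction q) (below a ℕP.≤-refl)
    , subst (λ v → v Q.* u Q.< r) (neg-as-fraction q) (below (ℤ.- a) (ℕP.≤-reflexive (ℤP.∣-i∣≡∣i∣ a)))
  where
  a = Q.↥ q
  k = ℚ.denominator-1 q
  A = ℤ.∣ a ∣
  N = A ℕ.* suc d
  u = + 1 / suc (m ℕ.* N)
  A-bound : A ℕ.* suc d ℕ.< suc n ℕ.* (suc k ℕ.* suc (m ℕ.* N))
  A-bound = begin-strict
    N                                    ≤⟨ ℕP.m≤n*m N m ⟩
    m ℕ.* N                              <⟨ ℕP.n<1+n _ ⟩
    suc (m ℕ.* N)                        ≤⟨ ℕP.m≤n*m _ (suc k) ⟩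
    suc k ℕ.* suc (m ℕ.* N)              ≤⟨ ℕP.m≤n*m _ (suc n) ⟩
    suc n ℕ.* (suc k ℕ.* suc (m ℕ.* N))  ∎
    where open ℕP.≤-Reasoning
  below : ∀ b → ℤ.∣ b ∣ ℕ.≤ A → (b / suc k) Q.* u Q.< r
  below b b≤A = subst (Q._< r) (sym (fromℚᵘ-* (mkℚᵘ b k) (mkℚᵘ (+ 1) (m ℕ.* N))))
    (fraction-below (b ℤ.* + 1) (m ℕ.* N ℕ.+ k ℕ.* suc (m ℕ.* N)) n d A
      (subst (ℕ._≤ A) (cong ℤ.∣_∣ (sym (ℤP.*-identityʳ b))) b≤A) A-bound)

lt→pos : ∀ {p r} → p Q.< r → 0ℚ Q.< r Q.- p
lt→pos {p} {r} p<r = subst (Q._< r Q.- p) (QP.+-inverseʳ p) (QP.+-monoˡ-< (Q.- p) p<r)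

diff-zero : ∀ {x y} → x Q.- y ≡ 0ℚ → x ≡ y
diff-zero {x} {y} x-y≡0 = begin
  x                ≡⟨ solve 2 (λ x y → x := (x :+ :- y) :+ y) refl x y ⟩
  (x Q.- y) Q.+ y  ≡⟨ cong (Q._+ y) x-y≡0 ⟩
  0ℚ Q.+ y         ≡⟨ QP.+-identityˡ y ⟩
  y                ∎
  where open ≡-Reasoning

double : ∀ w → w Q.+ w ≡ ι 2 Q.* w
double = solve 1 (λ w → w :+ w := con (ι 2) :* w) refl

triple : ∀ w → w Q.+ (w Q.+ w) ≡ ι 3 Q.* w
triple = solve 1 (λ w → w :+ (w :+ w) := con (ι 3) :* w) refl

halving-cancel : ∀ z w c → z Q.- (w Q.+ w) ≡ ι 2 Q.* c → z Q.- ((w Q.+ c) Q.+ (w Q.+ c)) ≡ 0ℚ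
halving-cancel z w c e = begin
  z Q.- ((w Q.+ c) Q.+ (w Q.+ c))      ≡⟨ solve 3 (λ z w c → z :+ :- ((w :+ c) :+ (w :+ c))
                                               := (z :+ :- (w :+ w)) :+ :- (con (ι 2) :* c)) refl z w c ⟩
  (z Q.- (w Q.+ w)) Q.- ι 2 Q.* c      ≡⟨ cong (Q._- ι 2 Q.* c) e ⟩
  ι 2 Q.* c Q.- ι 2 Q.* c              ≡⟨ QP.+-inverseʳ (ι 2 Q.* c) ⟩
  0ℚ                                   ∎
  where open ≡-Reasoning

module Localisation {p : ℕ} (p-prime : Prime p) where

  instance
    p≢0 : NonZero p
    p≢0 = prime⇒nonZero p-prime

  p∤1 : ¬ p ∣ 1
  p∤1 = >⇒∤ (nonTrivial⇒n>1 p {{prime⇒nonTrivial p-prime}})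

  p∤1+p* : ∀ n → ¬ p ∣ suc (p ℕ.* n)
  p∤1+p* n p∣ = p∤1 (∣m+n∣m⇒∣n (subst (p ∣_) (ℕP.+-comm 1 (p ℕ.* n)) p∣) (m∣m*n n))

  p∤* : ∀ {m n} → ¬ p ∣ m → ¬ p ∣ n → ¬ p ∣ m ℕ.* n
  p∤* p∤m p∤n p∣mn = either p∤m p∤n (euclidsLemma _ _ p-prime p∣mn)

  InZ-0 : InZloc p 0ℚ
  InZ-0 = + 0 , 0 , p∤1 , refl

  InZ-int : ∀ a → InZloc p (a / 1)
  InZ-int a = a , 0 , p∤1 , refl

  InZ-+ : ∀ {q r} → InZloc p q → InZloc p r → InZloc p (q Q.+ r)
  InZ-+ (a , k , p∤k , refl) (b , l , p∤l , refl) =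
    a ℤ.* + suc l ℤ.+ b ℤ.* + suc k , l ℕ.+ k ℕ.* suc l , p∤* p∤k p∤l ,
    fromℚᵘ-+ (mkℚᵘ a k) (mkℚᵘ b l)

  InZ-* : ∀ {q r} → InZloc p q → InZloc p r → InZloc p (q Q.* r)
  InZ-* (a , k , p∤k , refl) (b , l , p∤l , refl) =
    a ℤ.* b , l ℕ.+ k ℕ.* suc l , p∤* p∤k p∤l , fromℚᵘ-* (mkℚᵘ a k) (mkℚᵘ b l)

  InZ-neg : ∀ {q} → InZloc p q → InZloc p (Q.- q)
  InZ-neg (a , k , p∤k , refl) = ℤ.- a , k , p∤k , fromℚᵘ-neg (mkℚᵘ a k)

  InZ-unit : ∀ n → InZloc p (+ 1 / suc (p ℕ.* n))
  InZ-unit n = + 1 , p ℕ.* n , p∤1+p* n , refl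

  -- 1 is not divisible by p in ℤ_(p): from 1 = p·a/(k+1) we would get p ∣ k + 1.
  1≢p* : ∀ {w} → InZloc p w → 1ℚ ≢ ι p Q.* w
  1≢p* (a , k , p∤k , refl) 1≡pw with QP.fromℚᵘ-injective {mkℚᵘ (+ 1) 0} {mkℚᵘ (+ p) 0 U.* mkℚᵘ a k}
                                       (trans 1≡pw (fromℚᵘ-* (mkℚᵘ (+ p) 0) (mkℚᵘ a k)))
  ... | *≡* e = p∤k (divides ℤ.∣ a ∣ (begin
      suc k                          ≡⟨ trans (cong ℤ.∣_∣ (ℤP.*-identityˡ (+ (1 ℕ.* suc k))))
                                              (ℕP.*-identityˡ (suc k)) ⟨
      ℤ.∣ + 1 ℤ.* + (1 ℕ.* suc k) ∣  ≡⟨ cong ℤ.∣_∣ e ⟩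
      ℤ.∣ + p ℤ.* a ℤ.* + 1 ∣        ≡⟨ cong ℤ.∣_∣ (ℤP.*-identityʳ (+ p ℤ.* a)) ⟩
      ℤ.∣ + p ℤ.* a ∣                ≡⟨ ℤP.abs-* (+ p) a ⟩
      p ℕ.* ℤ.∣ a ∣                  ≡⟨ ℕP.*-comm p _ ⟩
      ℤ.∣ a ∣ ℕ.* p                  ∎))
    where open ≡-Reasoning

  divide : ∀ m → ¬ p ∣ suc m → ∀ {q} → InZloc p q → Σ ℚ λ h → InZloc p h × (ι (suc m) Q.* h ≡ q)
  divide m p∤m {q} q∈ = q Q.* u , InZ-* q∈ (+ 1 , m , p∤m , refl) , (begin
      ι (suc m) Q.* (q Q.* u)  ≡⟨ solve 3 (λ n q u → n :* (q :* u) := q :* (u :* n)) refl (ι (suc m)) q u ⟩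
      q Q.* (u Q.* ι (suc m))  ≡⟨ cong (q Q.*_) (reciprocal m) ⟩
      q Q.* 1ℚ                 ≡⟨ QP.*-identityʳ q ⟩
      q                        ∎)
    where
    open ≡-Reasoning
    u = + 1 / suc m

  -- The integers ≡ 1 mod p are not divisible by p in ℤ_(p): 1 + pT = pw gives 1 = p(w - T).
  1+p*≢p* : ∀ T {w} → InZloc p w → ι (suc (p ℕ.* T)) ≢ ι p Q.* w
  1+p*≢p* T {w} w∈ e = 1≢p* (InZ-+ w∈ (InZ-neg (InZ-int (+ T)))) (begin
      1ℚ                                    ≡⟨ solve 2 (λ x t → con 1ℚ := (con 1ℚ :+ x :* t) :+ :- (x :* t))
                                                     refl (ι p) (ι T) ⟩
      (1ℚ Q.+ ι p Q.* ι T) Q.- ι p Q.* ι T  ≡⟨ cong (Q._- ι p Q.* ι T) (trans (sym (ι-suc-* p T)) e) ⟩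
      ι p Q.* w Q.- ι p Q.* ι T             ≡⟨ solve 3 (λ x w t → x :* w :+ :- (x :* t) := x :* (w :+ :- t))
                                                     refl (ι p) w (ι T) ⟩
      ι p Q.* (w Q.- ι T)                   ∎)
    where open ≡-Reasoning

  -- Arbitrarily small positive elements of ℤ_(p) that are not divisible by p,
  -- namely 1 / (1 + pN) for large N.
  small-non-multiple : ∀ r → 0ℚ Q.< r →
    Σ ℚ λ ε → InZloc p ε × (0ℚ Q.< ε) × (ε Q.< r) × (∀ {w} → InZloc p w → ε ≢ ι p Q.* w)
  small-non-multiple r 0<r with archimedean p 1ℚ r 0<r
  ... | N , ε<r , _ = ε , InZ-unit N , 0<ε , subst (Q._< r) (QP.*-identityˡ ε) ε<r , non-multiple
    where
    ε = + 1 / suc (p ℕ.* N)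
    0<ε : 0ℚ Q.< ε
    0<ε = fromℚᵘ-< {mkℚᵘ (+ 0) 0} {mkℚᵘ (+ 1) (p ℕ.* N)} (*<* (ℤ.+<+ (s≤s z≤n)))
    non-multiple : ∀ {w} → InZloc p w → ε ≢ ι p Q.* w
    non-multiple {w} w∈ ε≡pw = 1≢p* (InZ-* w∈ (InZ-int (+ suc (p ℕ.* N)))) (begin
      1ℚ                                  ≡⟨ reciprocal (p ℕ.* N) ⟨
      ε Q.* ι (suc (p ℕ.* N))             ≡⟨ cong (Q._* ι (suc (p ℕ.* N))) ε≡pw ⟩
      ι p Q.* w Q.* ι (suc (p ℕ.* N))     ≡⟨ QP.*-assoc (ι p) w _ ⟩
      ι p Q.* (w Q.* ι (suc (p ℕ.* N)))   ∎)
      where open ≡-Reasoning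

  -- Every element α of ℤ_(p) is arbitrarily close to p·ℤ_(p): with u = 1 / (1 + pN)
  -- and δ = α N u one has α - pδ = α u, which is small for large N.
  approximation : ∀ {α} → InZloc p α → ∀ r → 0ℚ Q.< r →
    Σ ℚ λ δ → InZloc p δ × (α Q.- ι p Q.* δ Q.< r) × (Q.- (α Q.- ι p Q.* δ) Q.< r)
  approximation {α} α∈ r 0<r with archimedean p α r 0<r
  ... | N , αu<r , -αu<r =
    δ , InZ-* α∈ (InZ-* (InZ-int (+ N)) (InZ-unit N)) ,
    subst (Q._< r) (sym α-pδ≡αu) αu<r ,
    subst (Q._< r) (sym (trans (cong Q.-_ α-pδ≡αu) (QP.neg-distribˡ-* α u))) -αu<r
    where
    u = + 1 / suc (p ℕ.* N)
    δ = α Q.* (ι N Q.* u)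
    u-inverse : u Q.* (1ℚ Q.+ ι p Q.* ι N) ≡ 1ℚ
    u-inverse = trans (cong (u Q.*_) (sym (ι-suc-* p N))) (reciprocal (p ℕ.* N))
    α-pδ≡αu : α Q.- ι p Q.* δ ≡ α Q.* u
    α-pδ≡αu = begin
      α Q.- ι p Q.* δ
        ≡⟨ solve 4 (λ a x n u → a :+ :- (x :* (a :* (n :* u)))
                                := a :* u :+ a :* (con 1ℚ :+ :- (u :* (con 1ℚ :+ x :* n))))
                   refl α (ι p) (ι N) u ⟩
      α Q.* u Q.+ α Q.* (1ℚ Q.- u Q.* (1ℚ Q.+ ι p Q.* ι N))
        ≡⟨ cong (λ t → α Q.* u Q.+ α Q.* (1ℚ Q.- t)) u-inverse ⟩
      α Q.* u Q.+ α Q.* (1ℚ Q.- 1ℚ)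
        ≡⟨ solve 2 (λ a u → a :* u :+ a :* (con 1ℚ :+ :- con 1ℚ) := a :* u) refl α u ⟩
      α Q.* u
        ∎
      where open ≡-Reasoning

isOdd : ℕ → Bool
isOdd zero          = false
isOdd (suc zero)    = true
isOdd (suc (suc j)) = isOdd j

half : ℕ → ℕ
half zero          = zero
half (suc zero)    = zero
half (suc (suc j)) = suc (half j)

dbl : ℕ → ℕ
dbl zero    = zero
dbl (suc n) = suc (suc (dbl n))

data Parity : ℕ → Set where
  even : ∀ n → Parity (dbl n)
  odd  : ∀ n → Parity (suc (dbl n))

parity : ∀ j → Parity j
parity zero          = even 0
parity (suc zero)    = odd 0
parity (suc (suc j)) with parity j
... | even n = even (suc n)
... | odd n  = odd (suc n)

half-dbl : ∀ n → half (dbl n) ≡ n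
half-dbl zero    = refl
half-dbl (suc n) = cong suc (half-dbl n)

half-sdbl : ∀ n → half (suc (dbl n)) ≡ n
half-sdbl zero    = refl
half-sdbl (suc n) = cong suc (half-sdbl n)

isOdd-dbl : ∀ n → isOdd (dbl n) ≡ false
isOdd-dbl zero    = refl
isOdd-dbl (suc n) = isOdd-dbl n

isOdd-sdbl : ∀ n → isOdd (suc (dbl n)) ≡ true
isOdd-sdbl zero    = refl
isOdd-sdbl (suc n) = isOdd-sdbl n

half-mono-≤ : ∀ {i j} → i ℕ.≤ j → half i ℕ.≤ half j
half-mono-≤ z≤n               = z≤n
half-mono-≤ (s≤s z≤n)         = z≤n
half-mono-≤ (s≤s (s≤s i≤j))   = s≤s (half-mono-≤ i≤j)

sdbl<dbl : ∀ {n m} → n ℕ.< m → suc (dbl n) ℕ.< dbl m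
sdbl<dbl {zero}  {suc m} (s≤s z≤n)   = s≤s (s≤s z≤n)
sdbl<dbl {suc n} {suc m} (s≤s n<m)   = s≤s (s≤s (sdbl<dbl n<m))

n≤dbl : ∀ n → n ℕ.≤ dbl n
n≤dbl zero    = z≤n
n≤dbl (suc n) = s≤s (ℕP.m≤n⇒m≤1+n (n≤dbl n))

select : Bool → ℚ × ℚ → ℚ
select true  = proj₁
select false = proj₂

flat : G₂ → ℕ → ℚ
flat u j = select (isOdd j) (u (half j))

flat-dbl : ∀ u n → flat u (dbl n) ≡ proj₂ (u n)
flat-dbl u n rewrite isOdd-dbl n | half-dbl n = refl

flat-sdbl : ∀ u n → flat u (suc (dbl n)) ≡ proj₁ (u n)
flat-sdbl u n rewrite isOdd-sdbl n | half-sdbl n = refl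

select-zero : ∀ b {c} → ZPair Zℚ Zℚ c → select b c ≡ 0ℚ
select-zero true  (z₁ , _) = z₁
select-zero false (_ , z₂) = z₂

-- Sign of a sequence f : ℕ → ℚ in the reverse-lexicographic order (larger positions
-- more significant): f leads at k if k is the largest position of its support and f k > 0.

ZeroSeq : (ℕ → ℚ) → Set
ZeroSeq f = ∀ i → f i ≡ 0ℚ

ZeroFrom : ℕ → (ℕ → ℚ) → Set
ZeroFrom j f = ∀ i → j ℕ.≤ i → f i ≡ 0ℚ

LeadsAt : ℕ → (ℕ → ℚ) → Set
LeadsAt k f = ZeroFrom (suc k) f × (0ℚ Q.< f k)

PosSeq : (ℕ → ℚ) → Set
PosSeq f = Σ ℕ λ k → LeadsAt k f

NonNegSeq : (ℕ → ℚ) → Set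
NonNegSeq f = PosSeq f ⊎ ZeroSeq f

ZΓ₂→ZeroSeq : ∀ u → ZΓ₂ u → ZeroSeq (flat u)
ZΓ₂→ZeroSeq u z i = select-zero (isOdd i) (z (half i))

ZeroSeq→ZΓ₂ : ∀ u → ZeroSeq (flat u) → ZΓ₂ u
ZeroSeq→ZΓ₂ u z n = trans (sym (flat-sdbl u n)) (z (suc (dbl n))) , trans (sym (flat-dbl u n)) (z (dbl n))

PΓ₂→PosSeq : ∀ u → PΓ₂ u → PosSeq (flat u)
PΓ₂→PosSeq u (n , later , inj₁ x>0) =
  suc (dbl n) , (λ i 2n+1<i → beyond i (subst (ℕ._≤ half i) (half-dbl (suc n)) (half-mono-≤ 2n+1<i)))
              , subst (0ℚ Q.<_) (sym (flat-sdbl u n)) x>0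
  where
  beyond : ∀ i → n ℕ.< half i → flat u i ≡ 0ℚ
  beyond i n<i = select-zero (isOdd i) (later (half i) n<i)
PΓ₂→PosSeq u (n , later , inj₂ (x≡0 , y>0)) =
  dbl n , beyond , subst (0ℚ Q.<_) (sym (flat-dbl u n)) y>0
  where
  beyond : ZeroFrom (suc (dbl n)) (flat u)
  beyond i 2n<i with ℕP.m≤n⇒m<n∨m≡n (subst (ℕ._≤ half i) (half-sdbl n) (half-mono-≤ 2n<i))
  ... | inj₁ n<i = select-zero (isOdd i) (later (half i) n<i)
  ... | inj₂ n≡i with parity i
  ...   | even m = ⊥-elim (ℕP.<-irrefl (cong dbl (trans n≡i (half-dbl m))) 2n<i)
  ...   | odd m  = trans (flat-sdbl u m) (subst (λ k → proj₁ (u k) ≡ 0ℚ) (trans n≡i (half-sdbl m)) x≡0)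

PosSeq→PΓ₂ : ∀ u → PosSeq (flat u) → PΓ₂ u
PosSeq→PΓ₂ u (j , zero-above , f>0) with parity j
... | odd n  = n , later , inj₁ (subst (0ℚ Q.<_) (flat-sdbl u n) f>0)
  where
  later : ∀ m → n ℕ.< m → ZPair Zℚ Zℚ (u m)
  later m n<m = trans (sym (flat-sdbl u m)) (zero-above _ (s≤s (ℕP.<⇒≤ (sdbl<dbl n<m))))
              , trans (sym (flat-dbl u m)) (zero-above _ (sdbl<dbl n<m))
... | even n = n , later , inj₂ (trans (sym (flat-sdbl u n)) (zero-above _ ℕP.≤-refl)
                                , subst (0ℚ Q.<_) (flat-dbl u n) f>0)
  where
  later : ∀ m → n ℕ.< m → ZPair Zℚ Zℚ (u m)
  later m n<m = trans (sym (flat-sdbl u m)) (zero-above _ (ℕP.m≤n⇒m≤1+n (ℕP.<⇒≤ (sdbl<dbl n<m))))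
              , trans (sym (flat-dbl u m)) (zero-above _ (ℕP.<⇒≤ (sdbl<dbl n<m)))

NonNegSeq-resp : ∀ {f g} → (∀ i → f i ≡ g i) → NonNegSeq f → NonNegSeq g
NonNegSeq-resp f≗g (inj₁ (k , zero-above , fk>0)) =
  inj₁ (k , (λ i k<i → trans (sym (f≗g i)) (zero-above i k<i)) , subst (0ℚ Q.<_) (f≗g k) fk>0)
NonNegSeq-resp f≗g (inj₂ f≡0) = inj₂ (λ i → trans (sym (f≗g i)) (f≡0 i))

nonneg-top : ∀ {f} k → NonNegSeq f → ZeroFrom (suc k) f → ¬ (f k Q.< 0ℚ)
nonneg-top k (inj₂ f≡0) _ fk<0 = QP.<-irrefl (f≡0 k) fk<0
nonneg-top k (inj₁ (p , zero-above , fp>0)) zero-above-k fk<0 with ℕP.<-cmp p k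
... | tri< p<k _ _  = QP.<-irrefl (zero-above k p<k) fk<0
... | tri≈ _ refl _ = QP.<-asym fp>0 fk<0
... | tri> _ _ k<p  = QP.<-irrefl (sym (zero-above-k p k<p)) fp>0

-- If -s and s agree on [j, ∞) with nonnegative sequences, then s vanishes there:
-- the sequence form of  |s| ≤ 0  on a final segment.
tail-vanishes : ∀ {U V} (s : ℕ → ℚ) j → NonNegSeq U → NonNegSeq V →
              (∀ i → j ℕ.≤ i → U i ≡ Q.- s i) → (∀ i → j ℕ.≤ i → V i ≡ s i) → ZeroFrom j s
tail-vanishes s j (inj₂ U≡0) _ U≡-s _ i j≤i = QP.neg-injective (trans (sym (U≡-s i j≤i)) (U≡0 i))
tail-vanishes {U} {V} s j (inj₁ (p , U-above , Up>0)) V≥0 U≡-s V≡s i j≤i with j ℕ.≤? p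
... | no j≰p = QP.neg-injective (trans (sym (U≡-s i j≤i)) (U-above i (ℕP.<-≤-trans (ℕP.≰⇒> j≰p) j≤i)))
... | yes j≤p = ⊥-elim (nonneg-top p V≥0 V-above Vp<0)
  where
  V-above : ZeroFrom (suc p) V
  V-above i p<i = trans (V≡s i j≤i′) (QP.neg-injective (trans (sym (U≡-s i j≤i′)) (U-above i p<i)))
    where j≤i′ = ℕP.≤-trans j≤p (ℕP.<⇒≤ p<i)
  Vp<0 : V p Q.< 0ℚ
  Vp<0 = subst (Q._< 0ℚ) (trans (neg-involutive (s p)) (sym (V≡s p j≤p)))
               (QP.neg-antimono-< (subst (0ℚ Q.<_) (U≡-s p j≤p) Up>0))

module Dominance {f g h : ℕ → ℚ} (h≗g-f : ∀ i → h i ≡ g i Q.- f i) (h≥0 : NonNegSeq h) where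

  h≡-f : ∀ {i} → g i ≡ 0ℚ → h i ≡ Q.- f i
  h≡-f {i} gi≡0 = trans (h≗g-f i) (trans (cong (Q._- f i) gi≡0) (QP.+-identityˡ _))

  no-lead-over-zero : ∀ k → LeadsAt k f → ¬ ZeroFrom k g
  no-lead-over-zero k (f-above , fk>0) g-from = nonneg-top k h≥0 h-above hk<0
    where
    h-above : ZeroFrom (suc k) h
    h-above i k<i = trans (h≡-f (g-from i (ℕP.<⇒≤ k<i))) (cong Q.-_ (f-above i k<i))
    hk<0 : h k Q.< 0ℚ
    hk<0 = subst (Q._< 0ℚ) (sym (h≡-f (g-from k ℕP.≤-refl))) (QP.neg-antimono-< fk>0)

  dominated-zero : ∀ k → NonNegSeq f → ZeroFrom (suc k) g → ZeroFrom (suc k) f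
  dominated-zero k (inj₂ f≡0) _ i _ = f≡0 i
  dominated-zero k (inj₁ (p , f-lead)) g-above i k<i with p ℕ.≤? k
  ... | yes p≤k = proj₁ f-lead i (ℕP.≤-<-trans p≤k k<i)
  ... | no p≰k  = ⊥-elim (no-lead-over-zero p f-lead
                            (λ j p≤j → g-above j (ℕP.<-≤-trans (ℕP.≰⇒> p≰k) p≤j)))

  dominating-lead : ∀ k → LeadsAt k f → NonNegSeq g → Σ ℕ λ p → k ℕ.≤ p × LeadsAt p g
  dominating-lead k f-lead (inj₂ g≡0) = ⊥-elim (no-lead-over-zero k f-lead (λ i _ → g≡0 i))
  dominating-lead k f-lead (inj₁ (p , g-lead)) with k ℕ.≤? p
  ... | yes k≤p = p , k≤p , g-lead
  ... | no k≰p  = ⊥-elim (no-lead-over-zero k f-lead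
                            (λ i k≤i → proj₁ g-lead i (ℕP.<-≤-trans (ℕP.≰⇒> k≰p) k≤i)))

zero-from-step : ∀ {f} k → ZeroFrom (suc k) f → f k ≡ 0ℚ → ZeroFrom k f
zero-from-step k above fk≡0 i k≤i with ℕP.m≤n⇒m<n∨m≡n k≤i
... | inj₁ k<i   = above i k<i
... | inj₂ refl  = fk≡0

top-sign : ∀ {f} k → NonNegSeq f → ZeroFrom (suc k) f → (f k ≡ 0ℚ) ⊎ (0ℚ Q.< f k)
top-sign {f} k f≥0 above with QP.<-cmp (f k) 0ℚ
... | tri< fk<0 _ _ = ⊥-elim (nonneg-top k f≥0 above fk<0)
... | tri≈ _ fk≡0 _ = inj₁ fk≡0
... | tri> _ _ fk>0 = inj₂ fk>0

2-prime : Prime 2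
2-prime = from-yes (prime? 2)

3-prime : Prime 3
3-prime = from-yes (prime? 3)

module X = Localisation 2-prime
module Y = Localisation 3-prime

coords : G → ℕ → ℚ
coords g = flat (proj₁ g)

_-Γ_ : G → G → G
x -Γ y = x +Γ (-Γ y)

select-+ : ∀ b (c c' : ℚ × ℚ) →
           select b ((proj₁ c Q.+ proj₁ c') , (proj₂ c Q.+ proj₂ c')) ≡ select b c Q.+ select b c'
select-+ true  _ _ = refl
select-+ false _ _ = refl

select-neg : ∀ b (c : ℚ × ℚ) → select b (Q.- proj₁ c , Q.- proj₂ c) ≡ Q.- select b c
select-neg true  _ = refl
select-neg false _ = refl

coords-+ : ∀ g h i → coords (g +Γ h) i ≡ coords g i Q.+ coords h i
coords-+ g h i = select-+ (isOdd i) (proj₁ g (half i)) (proj₁ h (half i))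

coords-neg : ∀ g i → coords (-Γ g) i ≡ Q.- coords g i
coords-neg g i = select-neg (isOdd i) (proj₁ g (half i))

coords-0 : ∀ i → coords 0Γ i ≡ 0ℚ
coords-0 i = select-zero (isOdd i) (refl , refl)

coords-- : ∀ g h i → coords (g -Γ h) i ≡ coords g i Q.- coords h i
coords-- g h i = trans (coords-+ g (-Γ h) i) (cong (coords g i Q.+_) (coords-neg h i))

coords-diff-zero : ∀ t s i → coords t i ≡ 0ℚ → coords (t -Γ s) i ≡ Q.- coords s i
coords-diff-zero t s i ti≡0 = trans (coords-- t s i) (trans (cong (Q._- coords s i) ti≡0) (QP.+-identityˡ _))

coords-sub-sum : ∀ g u v i → coords (g -Γ (u +Γ v)) i ≡ coords g i Q.- (coords u i Q.+ coords v i)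
coords-sub-sum g u v i = trans (coords-- g (u +Γ v) i) (cong (λ c → coords g i Q.- c) (coords-+ u v i))

coords-sub-double : ∀ g w i → coords (g -Γ (w +Γ w)) i ≡ coords g i Q.- ι 2 Q.* coords w i
coords-sub-double g w i = trans (coords-- g (w +Γ w) i)
  (cong (λ c → coords g i Q.- c) (trans (coords-+ w w i) (double (coords w i))))

coords-sub-triple : ∀ g w i → coords (g -Γ (w +Γ (w +Γ w))) i ≡ coords g i Q.- ι 3 Q.* coords w i
coords-sub-triple g w i = trans (coords-- g (w +Γ (w +Γ w)) i)
  (cong (λ c → coords g i Q.- c) (trans (coords-+ w (w +Γ w) i)
    (trans (cong (coords w i Q.+_) (coords-+ w w i)) (triple (coords w i)))))

primeOf : Bool → ℕ
primeOf true  = 2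
primeOf false = 3

coordPrime : ℕ → ℕ
coordPrime j = primeOf (isOdd j)

coordPrime-odd : ∀ n → coordPrime (suc (dbl n)) ≡ 2
coordPrime-odd n = cong primeOf (isOdd-sdbl n)

coordPrime-even : ∀ n → coordPrime (dbl n) ≡ 3
coordPrime-even n = cong primeOf (isOdd-dbl n)

coords-mem : ∀ {g} → MemΓ g → ∀ j → InZloc (coordPrime j) (coords g j)
coords-mem {g} ((mem₂ , _) , _) j = select-mem (isOdd j) (mem₂ (half j))
  where
  select-mem : ∀ b {c} → InX (proj₁ c) × InY (proj₂ c) → InZloc (primeOf b) (select b c)
  select-mem true  (x∈ , _) = x∈
  select-mem false (_ , y∈) = y∈

-- The most significant summand ⊕_ℕ Y of Γ₁, whose coordinates all lie in Y.
Γ₁-head : G → ℕ → ℚ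
Γ₁-head g = proj₁ (proj₂ g 0)

Γ₁-head-mem : ∀ {g} → MemΓ g → ∀ m → InY (Γ₁-head g m)
Γ₁-head-mem (_ , mem₁ , _) m = proj₁ (mem₁ 0) m

single : ℕ → ℚ → ℕ → ℚ
single j c i with i ℕ.≟ j
... | yes _ = c
... | no _  = 0ℚ

single-same : ∀ j c → single j c j ≡ c
single-same j c with j ℕ.≟ j
... | yes _  = refl
... | no j≢j = ⊥-elim (j≢j refl)

single-other : ∀ j c i → i ≢ j → single j c i ≡ 0ℚ
single-other j c i i≢j with i ℕ.≟ j
... | yes i≡j = ⊥-elim (i≢j i≡j)
... | no _    = refl

single-elim : ∀ (P : ℚ → Set) j c i → P 0ℚ → (i ≡ j → P c) → P (single j c i)
single-elim P j c i P0 Pc with i ℕ.≟ j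
... | yes i≡j = Pc i≡j
... | no _    = P0

single-abs-below : ∀ j {c r} i → 0ℚ Q.< c → c Q.< r → (single j c i Q.< r) × (Q.- single j c i Q.< r)
single-abs-below j {c} {r} i 0<c c<r =
  single-elim (λ v → (v Q.< r) × (Q.- v Q.< r)) j c i (0<r , 0<r)
              (λ _ → c<r , QP.<-trans (QP.neg-antimono-< 0<c) 0<r)
  where 0<r = QP.<-trans 0<c c<r

Γ₁-zero : G₁
Γ₁-zero _ = (λ _ → 0ℚ) , 0ℚ

atΓ₂ : ℕ → ℚ → G
atΓ₂ j c = (λ n → single j c (suc (dbl n)) , single j c (dbl n)) , Γ₁-zero

atΓ₁ : ℕ → ℚ → G
atΓ₁ m c = (λ _ → 0ℚ , 0ℚ) , summands
  where
  summands : G₁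
  summands zero    = single m c , 0ℚ
  summands (suc _) = (λ _ → 0ℚ) , 0ℚ

coords-atΓ₂ : ∀ j c i → coords (atΓ₂ j c) i ≡ single j c i
coords-atΓ₂ j c i with parity i
... | even m rewrite isOdd-dbl m  | half-dbl m  = refl
... | odd m  rewrite isOdd-sdbl m | half-sdbl m = refl

coords-atΓ₁ : ∀ m c i → coords (atΓ₁ m c) i ≡ 0ℚ
coords-atΓ₁ m c i = select-zero (isOdd i) (refl , refl)

FinSupp-zip : ∀ {A : Set} (Z : A → Set) {f g : ℕ → A} (op : A → A → A) →
              (∀ {a b} → Z a → Z b → Z (op a b)) →
              FinSupp Z f → FinSupp Z g → FinSupp Z (λ n → op (f n) (g n))
FinSupp-zip Z op zero-op (N , f-zero) (M , g-zero) =
  N ℕ.⊔ M , λ n N⊔M≤n → zero-op (f-zero n (ℕP.≤-trans (ℕP.m≤m⊔n N M) N⊔M≤n))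
                                (g-zero n (ℕP.≤-trans (ℕP.m≤n⊔m N M) N⊔M≤n))

0+0 : ∀ {a b} → a ≡ 0ℚ → b ≡ 0ℚ → a Q.+ b ≡ 0ℚ
0+0 refl refl = refl

_+₂_ : ℚ × ℚ → ℚ × ℚ → ℚ × ℚ
c +₂ c' = (proj₁ c Q.+ proj₁ c') , (proj₂ c Q.+ proj₂ c')

_+₁_ : (ℕ → ℚ) × ℚ → (ℕ → ℚ) × ℚ → (ℕ → ℚ) × ℚ
s +₁ t = (λ m → proj₁ s m Q.+ proj₁ t m) , (proj₂ s Q.+ proj₂ t)

mem-+ : ∀ {g h} → MemΓ g → MemΓ h → MemΓ (g +Γ h)
mem-+ ((g₂ , g₂-fin) , (g₁ , g₁-fin)) ((h₂ , h₂-fin) , (h₁ , h₁-fin)) =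
  ((λ n → X.InZ-+ (proj₁ (g₂ n)) (proj₁ (h₂ n)) , Y.InZ-+ (proj₂ (g₂ n)) (proj₂ (h₂ n))) ,
   FinSupp-zip (ZPair Zℚ Zℚ) _+₂_ (λ (a₁ , a₂) (b₁ , b₂) → 0+0 a₁ b₁ , 0+0 a₂ b₂) g₂-fin h₂-fin) ,
  ((λ n → summand (g₁ n) (h₁ n)) ,
   FinSupp-zip (ZPair (ZSeq Zℚ) Zℚ) _+₁_ (λ (a₁ , a₂) (b₁ , b₂) → (λ m → 0+0 (a₁ m) (b₁ m)) , 0+0 a₂ b₂)
               g₁-fin h₁-fin)
  where
  summand : ∀ {s t : (ℕ → ℚ) × ℚ} →
            (∀ m → InY (proj₁ s m)) × FinSupp Zℚ (proj₁ s) × InX (proj₂ s) →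
            (∀ m → InY (proj₁ t m)) × FinSupp Zℚ (proj₁ t) × InX (proj₂ t) →
            (∀ m → InY (proj₁ (s +₁ t) m)) × FinSupp Zℚ (proj₁ (s +₁ t)) × InX (proj₂ (s +₁ t))
  summand (s-mem , s-fin , s-x) (t-mem , t-fin , t-x) =
    (λ m → Y.InZ-+ (s-mem m) (t-mem m)) , FinSupp-zip Zℚ Q._+_ 0+0 s-fin t-fin , X.InZ-+ s-x t-x

mem-Γ₁-zero : (∀ n → (∀ m → InY (proj₁ (Γ₁-zero n) m)) × FinSupp Zℚ (proj₁ (Γ₁-zero n))
                     × InX (proj₂ (Γ₁-zero n)))
            × FinSupp (ZPair (ZSeq Zℚ) Zℚ) Γ₁-zero
mem-Γ₁-zero = (λ _ → (λ _ → Y.InZ-0) , (0 , λ _ _ → refl) , X.InZ-0) , (0 , λ _ _ → (λ _ → refl) , refl)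

mem-0 : MemΓ 0Γ
mem-0 = ((λ _ → X.InZ-0 , Y.InZ-0) , (0 , λ _ _ → refl , refl)) , mem-Γ₁-zero

mem-atΓ₂ : ∀ j {c} → InZloc (coordPrime j) c → MemΓ (atΓ₂ j c)
mem-atΓ₂ j {c} c∈ = ((λ n → x-mem n , y-mem n) , (suc j , far)) , mem-Γ₁-zero
  where
  c∈-at : ∀ i → i ≡ j → InZloc (coordPrime i) c
  c∈-at i refl = c∈
  x-mem : ∀ n → InX (single j c (suc (dbl n)))
  x-mem n = single-elim InX j c (suc (dbl n)) X.InZ-0
              (λ e → subst (λ r → InZloc r c) (coordPrime-odd n) (c∈-at _ e))
  y-mem : ∀ n → InY (single j c (dbl n))
  y-mem n = single-elim InY j c (dbl n) Y.InZ-0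
              (λ e → subst (λ r → InZloc r c) (coordPrime-even n) (c∈-at _ e))
  far : ∀ n → suc j ℕ.≤ n → ZPair Zℚ Zℚ (proj₁ (atΓ₂ j c) n)
  far n j<n = single-other j c _ (λ e → ℕP.<-irrefl (sym e) (ℕP.≤-trans j<n (ℕP.m≤n⇒m≤1+n (n≤dbl n))))
            , single-other j c _ (λ e → ℕP.<-irrefl (sym e) (ℕP.≤-trans j<n (n≤dbl n)))

mem-atΓ₁ : ∀ m {c} → InY c → MemΓ (atΓ₁ m c)
mem-atΓ₁ m {c} c∈ = ((λ _ → X.InZ-0 , Y.InZ-0) , (0 , λ _ _ → refl , refl)) , (summand-mem , (1 , far))
  where
  summand-mem : ∀ n → (∀ i → InY (proj₁ (proj₂ (atΓ₁ m c) n) i))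
                      × FinSupp Zℚ (proj₁ (proj₂ (atΓ₁ m c) n)) × InX (proj₂ (proj₂ (atΓ₁ m c) n))
  summand-mem zero    = (λ i → single-elim InY m c i Y.InZ-0 (λ _ → c∈)) ,
                        (suc m , λ i m<i → single-other m c i (λ e → ℕP.<-irrefl (sym e) m<i)) , X.InZ-0
  summand-mem (suc n) = (λ _ → Y.InZ-0) , (0 , λ _ _ → refl) , X.InZ-0
  far : ∀ n → 1 ℕ.≤ n → ZPair (ZSeq Zℚ) Zℚ (proj₂ (atΓ₁ m c) n)
  far (suc n) _ = (λ _ → refl) , refl

PΓ→NonNeg : ∀ g → PΓ g → NonNegSeq (coords g)
PΓ→NonNeg g (inj₁ g₂>0)      = inj₁ (PΓ₂→PosSeq (proj₁ g) g₂>0)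
PΓ→NonNeg g (inj₂ (g₂≡0 , _)) = inj₂ (ZΓ₂→ZeroSeq (proj₁ g) g₂≡0)

pos→NonNeg : ∀ g → 0Γ <Γ g → NonNegSeq (coords g)
pos→NonNeg g 0<g = NonNegSeq-resp g-0≗g (PΓ→NonNeg (g -Γ 0Γ) 0<g)
  where
  g-0≗g : ∀ i → coords (g -Γ 0Γ) i ≡ coords g i
  g-0≗g i = trans (coords-- g 0Γ i) (trans (cong (λ z → coords g i Q.- z) (coords-0 i)) (QP.+-identityʳ _))

lt-by-lead : ∀ {s t} k → ZeroFrom (suc k) (coords t) → ZeroFrom (suc k) (coords s) →
             coords s k Q.< coords t k → s <Γ t
lt-by-lead {s} {t} k t-above s-above sk<tk =
  inj₁ (PosSeq→PΓ₂ (proj₁ (t -Γ s))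
         (k , (λ i k<i → trans (coords-- t s i) (cong₂ Q._-_ (t-above i k<i) (s-above i k<i)))
            , subst (0ℚ Q.<_) (sym (coords-- t s k)) (lt→pos sk<tk)))

Γ₁-lt-at : ∀ {s t} m → ZeroSeq (coords s) → ZeroSeq (coords t) →
           (∀ i → i ℕ.< m → Γ₁-head s i ≡ Γ₁-head t i) → Γ₁-head s m Q.< Γ₁-head t m → s <Γ t
Γ₁-lt-at {s} {t} m s₂≡0 t₂≡0 agree sm<tm =
  inj₂ (ZeroSeq→ZΓ₂ (proj₁ (t -Γ s))
          (λ i → trans (coords-diff-zero t s i (t₂≡0 i)) (cong Q.-_ (s₂≡0 i))) ,
        (0 , (λ _ ()) , inj₁ (m , (λ i i<m → trans (cong (λ c → Γ₁-head t i Q.- c) (agree i i<m))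
                                                    (QP.+-inverseʳ (Γ₁-head t i)))
                                 , lt→pos sm<tm)))

Γ₁-head-nonneg : ∀ g → PΓ g → ZeroSeq (coords g) → 0ℚ Q.≤ Γ₁-head g 0
Γ₁-head-nonneg g (inj₁ g₂>0) g₂≡0 with PΓ₂→PosSeq (proj₁ g) g₂>0
... | k , _ , gk>0 = ⊥-elim (QP.<-irrefl (sym (g₂≡0 k)) gk>0)
Γ₁-head-nonneg g (inj₂ (_ , g₁>0)) _ = head g₁>0
  where
  head : PΓ₁ (proj₂ g) → 0ℚ Q.≤ Γ₁-head g 0
  head (suc n , earlier , _)                 = QP.≤-reflexive (sym (proj₁ (earlier 0 (s≤s z≤n)) 0))
  head (zero , _ , inj₂ (head≡0 , _))         = QP.≤-reflexive (sym (head≡0 0))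
  head (zero , _ , inj₁ (zero , _ , h₀>0))    = QP.<⇒≤ h₀>0
  head (zero , _ , inj₁ (suc m , earlier , _)) = QP.≤-reflexive (sym (earlier 0 (s≤s z≤n)))

AbsLt : G → G → Set
AbsLt s t = (s <Γ t) × ((-Γ s) <Γ t)

bounded-tail : ∀ {s t} j → ZeroFrom j (coords t) → AbsLt s t → ZeroFrom j (coords s)
bounded-tail {s} {t} j t-from (s<t , -s<t) =
  tail-vanishes (coords s) j (PΓ→NonNeg (t -Γ s) s<t) (PΓ→NonNeg (t -Γ (-Γ s)) -s<t)
    (λ i j≤i → coords-diff-zero t s i (t-from i j≤i))
    (λ i j≤i → trans (coords-diff-zero t (-Γ s) i (t-from i j≤i))
                     (trans (cong Q.-_ (coords-neg s i)) (neg-involutive (coords s i))))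

lead-bound : ∀ {s t} k → LeadsAt k (coords t) → ZeroFrom (suc k) (coords s) →
             coords s k Q.< coords t k → Q.- coords s k Q.< coords t k → AbsLt s t
lead-bound {s} {t} k (t-above , _) s-above sk<tk -sk<tk =
  lt-by-lead {s} {t} k t-above s-above sk<tk ,
  lt-by-lead { -Γ s} {t} k t-above (λ i k<i → trans (coords-neg s i) (cong Q.-_ (s-above i k<i)))
                       (subst (Q._< coords t k) (sym (coords-neg s k)) -sk<tk)

bounded-head : ∀ {s t} → ZeroSeq (coords t) → Γ₁-head t 0 ≡ 0ℚ → AbsLt s t → Γ₁-head s 0 ≡ 0ℚ
bounded-head {s} {t} t₂≡0 t₁≡0 (s<t , -s<t) = QP.≤-antisym s₁≤0 0≤s₁
  where
  s₂≡0 : ZeroFrom 0 (coords s)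
  s₂≡0 = bounded-tail {s} {t} 0 (λ i _ → t₂≡0 i) (s<t , -s<t)
  0≤-u₁ : ∀ u → ZeroSeq (coords u) → u <Γ t → 0ℚ Q.≤ Q.- Γ₁-head u 0
  0≤-u₁ u u₂≡0 u<t = subst (0ℚ Q.≤_) (trans (cong (Q._- Γ₁-head u 0) t₁≡0) (QP.+-identityˡ _))
    (Γ₁-head-nonneg (t -Γ u) u<t (λ i → trans (coords-diff-zero t u i (t₂≡0 i)) (cong Q.-_ (u₂≡0 i))))
  s₁≤0 : Γ₁-head s 0 Q.≤ 0ℚ
  s₁≤0 = subst (Q._≤ 0ℚ) (neg-involutive _) (QP.neg-antimono-≤ (0≤-u₁ s (λ i → s₂≡0 i z≤n) s<t))
  0≤s₁ : 0ℚ Q.≤ Γ₁-head s 0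
  0≤s₁ = subst (0ℚ Q.≤_) (neg-involutive _)
    (0≤-u₁ (-Γ s) (λ i → trans (coords-neg s i) (cong Q.-_ (s₂≡0 i z≤n))) -s<t)

module SubTriple (g : G) (k : ℕ) (c : ℚ) where
  w : G
  w = atΓ₂ k c
  s : G
  s = g -Γ (w +Γ (w +Γ w))

  s-at : coords s k ≡ coords g k Q.- ι 3 Q.* c
  s-at = trans (coords-sub-triple g w k)
               (cong (λ v → coords g k Q.- ι 3 Q.* v) (trans (coords-atΓ₂ k c k) (single-same k c)))

  s-above : ZeroFrom (suc k) (coords g) → ZeroFrom (suc k) (coords s)
  s-above g-above i k<i = trans (coords-sub-triple g w i)
    (cong₂ (λ u v → u Q.- ι 3 Q.* v) (g-above i k<i)
           (trans (coords-atΓ₂ k c i) (single-other k c i (λ i≡k → ℕP.<-irrefl (sym i≡k) k<i))))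

-- The defining formula.  In its body the variables 0, 1, 2, 3 stand for d, b, a, x.

_⊖2_ _⊖3_ : ∀ {n} → Term n → Term n → Term n
z ⊖2 w = z ⊕ (⊝ (w ⊕ w))
z ⊖3 w = z ⊕ (⊝ (w ⊕ (w ⊕ w)))

_absLt_ : ∀ {n} → Term n → Term n → Formula n
s absLt t = (s ≺ t) ∧' ((⊝ s) ≺ t)

v0 : ∀ {n} → Term (suc n)
v0 = var zero
v1 : ∀ {n} → Term (suc (suc n))
v1 = var (suc zero)
v2 : ∀ {n} → Term (suc (suc (suc n)))
v2 = var (suc (suc zero))
v3 : ∀ {n} → Term (suc (suc (suc (suc n))))
v3 = var (suc (suc (suc zero)))
v4 : ∀ {n} → Term (suc (suc (suc (suc (suc n)))))
v4 = var (suc (suc (suc (suc zero))))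

halving : Formula 4
halving = ∀' (∀' (((v1 ⊖2 v0) absLt v4) ⇒' (∃' ((v2 ⊖2 v0) absLt v3))))

a-not-third : Formula 4
a-not-third = ∀' (¬' ((v3 ⊖3 v0) absLt v2))

b-not-third : Formula 4
b-not-third = ∀' (¬' ((v2 ⊖3 v0) absLt v1))

body : Formula 4
body = (v3 absLt v1) ∧' ((zer ≺ v0) ∧' ((v0 ≺ v1) ∧' ((v1 ≺ v2) ∧' ((zer ≺ v1) ∧' ((zer ≺ v2)
       ∧' (halving ∧' (a-not-third ∧' b-not-third)))))))

φH : Formula 1
φH = ∃' (∃' (∃' body))

sat-absLt : ∀ {n} {ρ : Env n} {s t} → AbsLt (eval ρ s) (eval ρ t) → Sat (s absLt t) ρ
sat-absLt (s<t , -s<t) = (λ k → k s<t) , (λ k → k -s<t)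

absLt-elim : ∀ {n} {ρ : Env n} {s t} → Sat (s absLt t) ρ → ¬ AbsLt (eval ρ s) (eval ρ t) → ⊥
absLt-elim (¬¬s<t , ¬¬-s<t) ¬abs = ¬¬s<t λ s<t → ¬¬-s<t λ -s<t → ¬abs (s<t , -s<t)

record OrderFacts (x a b d : G) : Set where
  field
    x-bound : AbsLt x b
    0<d     : 0Γ <Γ d
    d<b     : d <Γ b
    b<a     : b <Γ a
    0<b     : 0Γ <Γ b
    0<a     : 0Γ <Γ a

body-env : G → G → G → G → Env 4
body-env x a b d = ext d (ext b (ext a [ x ]))

module _ {x a b d : G} where
  private
    ρ = body-env x a b d

  sat-body : OrderFacts x a b d → Sat halving ρ → Sat a-not-third ρ → Sat b-not-third ρ → Sat body ρ
  sat-body facts I N1 N2 =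
    sat-absLt {ρ = ρ} {v3} {v1} x-bound ,
    (λ k → k 0<d) , (λ k → k d<b) , (λ k → k b<a) , (λ k → k 0<b) , (λ k → k 0<a) , I , N1 , N2
    where open OrderFacts facts

  body-elim : Sat body ρ →
              (OrderFacts x a b d → Sat halving ρ → Sat a-not-third ρ → Sat b-not-third ρ → ⊥) → ⊥
  body-elim (x-bound , ¬¬0<d , ¬¬d<b , ¬¬b<a , ¬¬0<b , ¬¬0<a , I , N1 , N2) k =
    absLt-elim {ρ = ρ} {v3} {v1} x-bound λ x-bound →
    ¬¬0<d λ 0<d → ¬¬d<b λ d<b → ¬¬b<a λ b<a → ¬¬0<b λ 0<b → ¬¬0<a λ 0<a →
    k (record { x-bound = x-bound ; 0<d = 0<d ; d<b = d<b ; b<a = b<a ; 0<b = 0<b ; 0<a = 0<a }) I N1 N2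

3∤2 : ¬ 3 ∣ 2
3∤2 = from-no (3 ∣? 2)

0<1 : 0ℚ Q.< 1ℚ
0<1 = 0<ι-suc 0

-- If x ∈ {0} ⊕ Γ₁ the body is satisfied by
--   a = 1 at the least significant Γ₂-coordinate (a Y-coordinate),
--   b = β at the first Γ₁-coordinate, where β = 1 + 3T > |x₁| for the first Γ₁-coordinate
--       x₁ of x and T the absolute value of its numerator; so β ∉ 3Y,
--   d = 1 at the second Γ₁-coordinate.
module Witnesses (x : G) (x∈H : InH x) where

  T = ℤ.∣ Q.↥ (Γ₁-head x 0) ∣
  β = ι (suc (3 ℕ.* T))

  a b d : G
  a = atΓ₂ 0 1ℚ
  b = atΓ₁ 0 β
  d = atΓ₁ 1 1ℚ

  ρ : Env 4
  ρ = body-env x a b d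

  a-mem : MemΓ a
  a-mem = mem-atΓ₂ 0 (Y.InZ-int (+ 1))
  b-mem : MemΓ b
  b-mem = mem-atΓ₁ 0 (Y.InZ-int (+ suc (3 ℕ.* T)))
  d-mem : MemΓ d
  d-mem = mem-atΓ₁ 1 (Y.InZ-int (+ 1))

  x₂≡0 : ZeroSeq (coords x)
  x₂≡0 = ZΓ₂→ZeroSeq (proj₁ x) x∈H
  -x₂≡0 : ZeroSeq (coords (-Γ x))
  -x₂≡0 i = trans (coords-neg x i) (cong Q.-_ (x₂≡0 i))
  b₂≡0 : ZeroSeq (coords b)
  b₂≡0 = coords-atΓ₁ 0 β
  d₂≡0 : ZeroSeq (coords d)
  d₂≡0 = coords-atΓ₁ 1 1ℚ
  a-above : ZeroFrom 1 (coords a)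
  a-above (suc i) _ = coords-atΓ₂ 0 1ℚ (suc i)

  0<β : 0ℚ Q.< β
  0<β = 0<ι-suc (3 ℕ.* T)

  facts : OrderFacts x a b d
  facts = record
    { x-bound = Γ₁-lt-at {x} {b} 0 x₂≡0 b₂≡0 (λ _ ()) (proj₁ (abs-below 3 (Γ₁-head x 0)))
              , Γ₁-lt-at { -Γ x} {b} 0 -x₂≡0 b₂≡0 (λ _ ()) (proj₂ (abs-below 3 (Γ₁-head x 0)))
    ; 0<d     = Γ₁-lt-at {0Γ} {d} 1 coords-0 d₂≡0 (λ { zero _ → refl ; (suc _) (s≤s ()) }) 0<1
    ; d<b     = Γ₁-lt-at {d} {b} 0 d₂≡0 b₂≡0 (λ _ ()) 0<β
    ; b<a     = lt-by-lead {b} {a} 0 a-above (λ i _ → b₂≡0 i) 0<1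
    ; 0<b     = Γ₁-lt-at {0Γ} {b} 0 coords-0 b₂≡0 (λ _ ()) 0<β
    ; 0<a     = lt-by-lead {0Γ} {a} 0 a-above (λ i _ → coords-0 i) 0<1
    }

  below-d : ∀ {s} → ZeroSeq (coords s) → Γ₁-head s 0 ≡ 0ℚ → Γ₁-head s 1 ≡ 0ℚ → AbsLt s d
  below-d {s} s₂≡0 s₀≡0 s₁≡0 =
    Γ₁-lt-at {s} {d} 1 s₂≡0 d₂≡0 (λ { zero _ → s₀≡0 ; (suc _) (s≤s ()) })
             (subst (Q._< 1ℚ) (sym s₁≡0) 0<1) ,
    Γ₁-lt-at { -Γ s} {d} 1 (λ i → trans (coords-neg s i) (cong Q.-_ (s₂≡0 i))) d₂≡0
             (λ { zero _ → cong Q.-_ s₀≡0 ; (suc _) (s≤s ()) }) (subst (Q._< 1ℚ) (sym (cong Q.-_ s₁≡0)) 0<1)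

  -- (I): if |z - 2w| < a, then z - 2w has no Γ₂-coordinates except at position 0, and
  -- there as well as at the first two Γ₁-coordinates its value can be halved in Y; adding
  -- these halves to w gives w' with z - 2w' below d.
  halve : ∀ {z w} → MemΓ z → MemΓ w → AbsLt (z -Γ (w +Γ w)) a →
          Σ G λ w' → MemΓ w' × AbsLt (z -Γ (w' +Γ w')) d
  halve {z} {w} z-mem w-mem bound =
    w' , mem-+ w-mem (mem-+ (mem-atΓ₂ 0 (proj₁ (proj₂ H₀)))
                            (mem-+ (mem-atΓ₁ 0 (proj₁ (proj₂ H₁))) (mem-atΓ₁ 1 (proj₁ (proj₂ H₂))))) ,
    below-d {s'} s'₂≡0
      (head-zero 0 (trans (QP.+-identityˡ _) (QP.+-identityʳ (proj₁ H₁))) (proj₂ (proj₂ H₁)))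
      (head-zero 1 (trans (QP.+-identityˡ _) (QP.+-identityˡ (proj₁ H₂))) (proj₂ (proj₂ H₂)))
    where
    sub-double-mem : ∀ {p q} → InY p → InY q → InY (p Q.- (q Q.+ q))
    sub-double-mem p∈ q∈ = Y.InZ-+ p∈ (Y.InZ-neg (Y.InZ-+ q∈ q∈))
    H₀ = Y.divide 1 3∤2 (sub-double-mem (coords-mem z-mem 0) (coords-mem w-mem 0))
    H₁ = Y.divide 1 3∤2 (sub-double-mem (Γ₁-head-mem z-mem 0) (Γ₁-head-mem w-mem 0))
    H₂ = Y.divide 1 3∤2 (sub-double-mem (Γ₁-head-mem z-mem 1) (Γ₁-head-mem w-mem 1))
    h₀ = proj₁ H₀
    Γ₁-corr = atΓ₁ 0 (proj₁ H₁) +Γ atΓ₁ 1 (proj₁ H₂)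
    corr = atΓ₂ 0 h₀ +Γ Γ₁-corr
    w' = w +Γ corr
    s' = z -Γ (w' +Γ w')
    coords-corr : ∀ i → coords corr i ≡ single 0 h₀ i
    coords-corr i = trans (coords-+ (atΓ₂ 0 h₀) Γ₁-corr i)
      (trans (cong₂ Q._+_ (coords-atΓ₂ 0 h₀ i) (select-zero (isOdd i) (refl , refl))) (QP.+-identityʳ _))
    t-halved : ∀ i → coords z i Q.- (coords w i Q.+ coords w i) ≡ ι 2 Q.* single 0 h₀ i
    t-halved zero    = sym (proj₂ (proj₂ H₀))
    t-halved (suc i) = trans (sym (coords-sub-sum z w w (suc i)))
                             (bounded-tail {z -Γ (w +Γ w)} {a} 1 a-above bound (suc i) (s≤s z≤n))
    s'₂≡0 : ZeroSeq (coords s')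
    s'₂≡0 i = begin
      coords s' i                                           ≡⟨ coords-sub-sum z w' w' i ⟩
      coords z i Q.- (coords w' i Q.+ coords w' i)          ≡⟨ cong (λ c → coords z i Q.- (c Q.+ c)) w'≡ ⟩
      coords z i Q.- ((coords w i Q.+ single 0 h₀ i) Q.+ (coords w i Q.+ single 0 h₀ i))
                                                ≡⟨ halving-cancel (coords z i) (coords w i) (single 0 h₀ i) (t-halved i) ⟩
      0ℚ                                                    ∎
      where
      open ≡-Reasoning
      w'≡ = trans (coords-+ w corr i) (cong (coords w i Q.+_) (coords-corr i))
    head-zero : ∀ m {h} → Γ₁-head corr m ≡ h → ι 2 Q.* h ≡ Γ₁-head z m Q.- (Γ₁-head w m Q.+ Γ₁-head w m) →
                Γ₁-head s' m ≡ 0ℚ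
    head-zero m {h} c≡h 2h≡ =
      trans (cong (λ c → Γ₁-head z m Q.- ((Γ₁-head w m Q.+ c) Q.+ (Γ₁-head w m Q.+ c))) c≡h)
            (halving-cancel (Γ₁-head z m) (Γ₁-head w m) h (sym 2h≡))

  halving-holds : Sat halving ρ
  halving-holds z z-mem w w-mem sat no-w' =
    absLt-elim {ρ = ext w (ext z ρ)} {v1 ⊖2 v0} {v4} sat λ bound →
      let (w' , w'-mem , bound') = halve z-mem w-mem bound
      in no-w' w' w'-mem (sat-absLt {ρ = ext w' (ext w (ext z ρ))} {v2 ⊖2 v0} {v3} bound')

  -- (N1): |a - 3w| < b ∈ Γ₁ forces 1 = 3w₀ in Y.
  a-not-third-holds : Sat a-not-third ρ
  a-not-third-holds w w-mem sat =
    absLt-elim {ρ = ext w ρ} {v3 ⊖3 v0} {v2} sat λ bound →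
      Y.1+p*≢p* 0 (coords-mem w-mem 0) (diff-zero (trans (sym (coords-sub-triple a w 0))
        (bounded-tail {a -Γ (w +Γ (w +Γ w))} {b} 0 (λ i _ → b₂≡0 i) bound 0 z≤n)))

  -- (N2): |b - 3w| < d forces β = 3w₁ in Y.
  b-not-third-holds : Sat b-not-third ρ
  b-not-third-holds w w-mem sat =
    absLt-elim {ρ = ext w ρ} {v2 ⊖3 v0} {v1} sat λ bound →
      Y.1+p*≢p* T (Γ₁-head-mem w-mem 0)
        (trans (diff-zero (bounded-head {b -Γ (w +Γ (w +Γ w))} {d} d₂≡0 refl bound)) (triple (Γ₁-head w 0)))

  holds : Sat φH [ x ]
  holds no-a = no-a a a-mem λ no-b → no-b b b-mem λ no-d →
    no-d d d-mem (sat-body facts halving-holds a-not-third-holds b-not-third-holds)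

2∤3 : ¬ 2 ∣ 3
2∤3 = from-no (2 ∣? 3)

-- Let k be the leading
-- Γ₂-position of b (it exists since |x| < b); a leads at some position ≥ k and d
-- vanishes above k.  Depending on the parity of k one of (I), (N1), (N2) fails.
module Refutation {x a b d : G} (a-mem : MemΓ a) (b-mem : MemΓ b) (d-mem : MemΓ d)
                  (facts : OrderFacts x a b d) where
  open OrderFacts facts

  ρ : Env 4
  ρ = body-env x a b d

  -- (I) fails if a leads at p ≥ q with q = 2n+1 odd and d vanishes from q on: for
  -- 0 < ε < a_p in X not divisible by 2, z = ε at q has |z - 2·0| < a, while
  -- |z - 2w'| < d would force ε = 2w'_q.
  halving-fails : ∀ n p → suc (dbl n) ℕ.≤ p → LeadsAt p (coords a) → ZeroFrom (suc (dbl n)) (coords d) →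
                  ¬ Sat halving ρ
  halving-fails n p q≤p a-lead d-from I =
    I z z-mem 0Γ mem-0 (sat-absLt {ρ = ext 0Γ (ext z ρ)} {v1 ⊖2 v0} {v4} z-bound) λ w' w'-mem sat →
      absLt-elim {ρ = ext w' (ext 0Γ (ext z ρ))} {v2 ⊖2 v0} {v3} sat (no-halving w' w'-mem)
    where
    q = suc (dbl n)
    E = X.small-non-multiple (coords a p) (proj₂ a-lead)
    ε = proj₁ E
    ε∈X = proj₁ (proj₂ E)
    0<ε = proj₁ (proj₂ (proj₂ E))
    ε<aₚ = proj₁ (proj₂ (proj₂ (proj₂ E)))
    ε-not-even = proj₂ (proj₂ (proj₂ (proj₂ E)))
    z = atΓ₂ q ε
    z-mem : MemΓ z
    z-mem = mem-atΓ₂ q (subst (λ r → InZloc r ε) (sym (coordPrime-odd n)) ε∈X)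
    z-0≗z : ∀ i → coords (z -Γ (0Γ +Γ 0Γ)) i ≡ single q ε i
    z-0≗z i = trans (coords-sub-double z 0Γ i)
      (trans (cong (λ v → coords z i Q.- ι 2 Q.* v) (coords-0 i)) (trans (QP.+-identityʳ _) (coords-atΓ₂ q ε i)))
    z-bound : AbsLt (z -Γ (0Γ +Γ 0Γ)) a
    z-bound = lead-bound {z -Γ (0Γ +Γ 0Γ)} {a} p a-lead
      (λ i p<i → trans (z-0≗z i)
                       (single-other q ε i (λ i≡q → ℕP.<-irrefl (sym i≡q) (ℕP.≤-<-trans q≤p p<i))))
      (subst (Q._< coords a p) (sym (z-0≗z p)) (proj₁ below))
      (subst (λ v → Q.- v Q.< coords a p) (sym (z-0≗z p)) (proj₂ below))
      where below = single-abs-below q p 0<ε ε<aₚ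
    no-halving : ∀ w' → MemΓ w' → ¬ AbsLt (z -Γ (w' +Γ w')) d
    no-halving w' w'-mem bound =
      ε-not-even (subst (λ r → InZloc r (coords w' q)) (coordPrime-odd n) (coords-mem w'-mem q)) (diff-zero (begin
        ε Q.- ι 2 Q.* coords w' q           ≡⟨ cong (λ v → v Q.- ι 2 Q.* coords w' q) zq≡ε ⟨
        coords z q Q.- ι 2 Q.* coords w' q  ≡⟨ coords-sub-double z w' q ⟨
        coords (z -Γ (w' +Γ w')) q          ≡⟨ bounded-tail {z -Γ (w' +Γ w')} {d} q d-from bound q ℕP.≤-refl ⟩
        0ℚ                                  ∎))
      where
      open ≡-Reasoning
      zq≡ε = trans (coords-atΓ₂ q ε q) (single-same q ε)

  -- (N2) fails if b and d both lead at the odd position k: w = b_k / 3 at k (3 is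
  -- invertible in X) makes b - 3w vanish from k on, so |b - 3w| < d.
  b-not-third-fails : ∀ n → LeadsAt (suc (dbl n)) (coords b) → LeadsAt (suc (dbl n)) (coords d) →
                      ¬ Sat b-not-third ρ
  b-not-third-fails n (b-above , _) d-lead N2 =
    N2 w (mem-atΓ₂ k (subst (λ r → InZloc r γ) (sym (coordPrime-odd n)) (proj₁ (proj₂ D))))
      (sat-absLt {ρ = ext w ρ} {v2 ⊖3 v0} {v1}
        (lead-bound {s} {d} k d-lead (s-above b-above)
          (subst (Q._< coords d k) (sym sₖ≡0) (proj₂ d-lead))
          (subst (λ v → Q.- v Q.< coords d k) (sym sₖ≡0) (proj₂ d-lead))))
    where
    k = suc (dbl n)
    D = X.divide 2 2∤3 (subst (λ r → InZloc r (coords b k)) (coordPrime-odd n) (coords-mem b-mem k))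
    γ = proj₁ D
    open SubTriple b k γ
    sₖ≡0 : coords s k ≡ 0ℚ
    sₖ≡0 = trans s-at (trans (cong (λ v → coords b k Q.- v) (proj₂ (proj₂ D))) (QP.+-inverseʳ (coords b k)))

  -- (N1) fails if a and b both lead at the even position k: for δ ∈ Y with
  -- |a_k - 3δ| < b_k (3Y is dense around Y), w = δ at k gives |a - 3w| < b.
  a-not-third-fails : ∀ n → LeadsAt (dbl n) (coords b) → LeadsAt (dbl n) (coords a) → ¬ Sat a-not-third ρ
  a-not-third-fails n b-lead (a-above , _) N1 =
    N1 w (mem-atΓ₂ k (subst (λ r → InZloc r δ) (sym (coordPrime-even n)) (proj₁ (proj₂ Δ))))
      (sat-absLt {ρ = ext w ρ} {v3 ⊖3 v0} {v2}
        (lead-bound {s} {b} k b-lead (s-above a-above)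
          (subst (Q._< coords b k) (sym s-at) (proj₁ (proj₂ (proj₂ Δ))))
          (subst (λ v → Q.- v Q.< coords b k) (sym s-at) (proj₂ (proj₂ (proj₂ Δ))))))
    where
    k = dbl n
    aₖ∈Y = subst (λ r → InZloc r (coords a k)) (coordPrime-even n) (coords-mem a-mem k)
    Δ = Y.approximation aₖ∈Y (coords b k) (proj₂ b-lead)
    δ = proj₁ Δ
    open SubTriple a k δ

  refute : ¬ ZeroSeq (coords x) → Sat halving ρ → Sat a-not-third ρ → Sat b-not-third ρ → ⊥
  refute x₂≢0 I N1 N2 = by-lead-of-b (pos→NonNeg b 0<b)
    where
    by-parity : ∀ {k} → Parity k → LeadsAt k (coords b) →
                Σ ℕ (λ p → k ℕ.≤ p × LeadsAt p (coords a)) → ZeroFrom (suc k) (coords d) → ⊥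
    by-parity (odd n) b-lead (p , k≤p , a-lead) d-above with top-sign (suc (dbl n)) (pos→NonNeg d 0<d) d-above
    ... | inj₁ dₖ≡0 = halving-fails n p k≤p a-lead (zero-from-step _ d-above dₖ≡0) I
    ... | inj₂ dₖ>0 = b-not-third-fails n b-lead (d-above , dₖ>0) N2
    by-parity (even n) b-lead (p , k≤p , a-lead) d-above with ℕP.m≤n⇒m<n∨m≡n k≤p
    ... | inj₁ k<p  = halving-fails n p k<p a-lead d-above I
    ... | inj₂ refl = a-not-third-fails n b-lead a-lead N1
    at-lead : ∀ k → LeadsAt k (coords b) → ⊥
    at-lead k b-lead = by-parity (parity k) b-lead
      (Dominance.dominating-lead (coords-- a b) (PΓ→NonNeg (a -Γ b) b<a) k b-lead (pos→NonNeg a 0<a))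
      (Dominance.dominated-zero (coords-- b d) (PΓ→NonNeg (b -Γ d) d<b) k (pos→NonNeg d 0<d) (proj₁ b-lead))
    by-lead-of-b : NonNegSeq (coords b) → ⊥
    by-lead-of-b (inj₁ (k , b-lead)) = at-lead k b-lead
    by-lead-of-b (inj₂ b₂≡0) = x₂≢0 (λ i → bounded-tail {x} {b} 0 (λ j _ → b₂≡0 j) x-bound i z≤n)

sat→InH : ∀ g → Sat φH [ g ] → InH g
sat→InH g sat = ZeroSeq→ZΓ₂ (proj₁ g) λ j → decide j
  where
  decide : ∀ j → coords g j ≡ 0ℚ
  decide j with coords g j QP.≟ 0ℚ
  ... | yes gj≡0 = gj≡0
  ... | no gj≢0 = ⊥-elim (sat λ a a-mem sat-a → sat-a λ b b-mem sat-b → sat-b λ d d-mem sat-body →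
                    body-elim sat-body λ facts I N1 N2 →
                      Refutation.refute a-mem b-mem d-mem facts (λ g₂≡0 → gj≢0 (g₂≡0 j)) I N1 N2)

lemma2p1 : Σ (Formula 1) λ φ →
    ∀ g → MemΓ g → (Sat φ [ g ] ⇔ InH g)
lemma2p1 = φH , λ g _ → mk⇔ (sat→InH g) (Witnesses.holds g)
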